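{- Every binary-explainable qBMG $(G,\sigma)$ is hourglass-free.
   Context: All rooted trees are phylogenetic; $v\preceq_T u$ means $u$ is on the path from root $\rho_T$ to $v$; $\mathrm{lca}_T$ is the least common ancestor. In leaf-colored $(T,\sigma)$, $y$ is a best match of $x$ if $\sigma(x)\ne\sigma(y)$ and $\mathrm{lca}_T(x,y)\preceq_T\mathrm{lca}_T(x,y')$ for all leaves $y'$ with $\sigma(y')=\sigma(y)$. A truncation map $u\colon L(T)\times S\to V(T)$ (with $\sigma(L(T))\subseteq S$) sends $(x,s)$ to a vertex on the path from $\rho_T$ to $x$, with $u(x,\sigma(x))=x$; $y$ is a quasi-best match of $x$ if it is a best match and $\mathrm{lca}_T(x,y)\preceq_T u(x,\sigma(y))$; $(T,\sigma,u)$ explains the vertex-colored digraph on $L(T)$ with arcs $xy$ for quasi-best matches $y$ of $x$. A binary-explainable qBMG is one explained by some $(T,\sigma,u)$ with $T$ binary. An hourglass in a properly vertex-colored digraph $(G,\sigma)$ is an induced subgraph on four pairwise distinct vertices $x,x',y,y'$ with (i) $\sigma(x)=\sigma(x')\ne\sigma(y)=\sigma(y')$, (ii) $xy,yx,x'y',y'x'\in E(G)$, (iii) $xy',yx'\in E(G)$, and (iv) $y'x,x'y\notin E(G)$. $(G,\sigma)$ is hourglass-free if it has no hourglass as an induced subgraph. -}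

module Defs where

open import Data.Product using (_×_; Σ)
open import Relation.Binary.PropositionalEquality using (_≡_)
open import Relation.Nullary using (¬_)

-- Binary phylogenetic rooted trees (up to isomorphism): every inner vertex
-- has exactly two children; the single-vertex tree is a leaf.
data Tree : Set where
  leaf : Tree
  node : Tree → Tree → Tree

-- Vertices of a tree, as positions reached from the root.
data Pos : Tree → Set where
  here  : ∀ {t} → Pos t
  left  : ∀ {t₁ t₂} → Pos t₁ → Pos (node t₁ t₂)
  right : ∀ {t₁ t₂} → Pos t₂ → Pos (node t₁ t₂)

-- Leaves L(T): positions whose subtree is a leaf.
data LPos : Tree → Set where
  here  : LPos leaf
  left  : ∀ {t₁ t₂} → LPos t₁ → LPos (node t₁ t₂)
  right : ∀ {t₁ t₂} → LPos t₂ → LPos (node t₁ t₂)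

toPos : ∀ {t} → LPos t → Pos t
toPos here      = here
toPos (left x)  = left (toPos x)
toPos (right x) = right (toPos x)

-- v ⪯ u : u lies on the path from the root to v.
data _⪯_ : ∀ {t} → Pos t → Pos t → Set where
  ⪯-root  : ∀ {t} {v : Pos t} → v ⪯ here
  ⪯-left  : ∀ {t₁ t₂} {v u : Pos t₁} → v ⪯ u → left {t₁} {t₂} v ⪯ left u
  ⪯-right : ∀ {t₁ t₂} {v u : Pos t₂} → v ⪯ u → right {t₁} {t₂} v ⪯ right u

lca : ∀ {t} → Pos t → Pos t → Pos t
lca (left a)  (left b)  = left (lca a b)
lca (right a) (right b) = right (lca a b)
lca _         _         = here

module _ {T : Tree} {S : Set} (σ : LPos T → S) where

  lcaL : LPos T → LPos T → Pos T
  lcaL x y = lca (toPos x) (toPos y)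

  BestMatch : LPos T → LPos T → Set
  BestMatch x y = (¬ σ x ≡ σ y)
                × (∀ y' → σ y' ≡ σ y → lcaL x y ⪯ lcaL x y')

  record Truncation : Set where
    field
      map  : LPos T → S → Pos T
      anc  : ∀ x s → toPos x ⪯ map x s
      self : ∀ x → map x (σ x) ≡ toPos x

  -- arcs of the digraph explained by (T, σ, u): quasi-best matches
  QBM : Truncation → LPos T → LPos T → Set
  QBM u x y = BestMatch x y × (lcaL x y ⪯ Truncation.map u x (σ y))

module _ {V S : Set} (E : V → V → Set) (σ : V → S) where

  Hourglass : V → V → V → V → Set
  Hourglass x x' y y' =
      (¬ x ≡ x') × (¬ x ≡ y) × (¬ x ≡ y') × (¬ x' ≡ y) × (¬ x' ≡ y') × (¬ y ≡ y')
    × (σ x ≡ σ x') × (¬ σ x ≡ σ y) × (σ y ≡ σ y')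
    × E x y × E y x × E x' y' × E y' x'
    × E x y' × E y x'
    × (¬ E y' x) × (¬ E x' y)

  HourglassFree : Set
  HourglassFree = ∀ x x' y y' → ¬ Hourglass x x' y y'

-- In a binary tree the lca v of two leaves a, b has exactly two children,
-- one above a and one above b.  For an hourglass x, x', y, y' the reciprocal
-- best matches force lca(x,y) = lca(x,y') = lca(x',y); so y' hangs below the
-- child of v that contains y, and x' below the one that contains x, whence
-- lca(y',x') = lca(y',x).  As σ x = σ x', the arc y'x' then transfers to an
-- arc y'x, which condition (iv) of an hourglass forbids.
module Submission where

open import Defs
open import Data.Product using (_,_)
open import Relation.Binary.PropositionalEquality
  using (_≡_; refl; sym; trans; cong; subst; subst₂; module ≡-Reasoning)

⪯-antisym : ∀ {t} {v u : Pos t} → v ⪯ u → u ⪯ v → v ≡ u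
⪯-antisym ⪯-root      ⪯-root      = refl
⪯-antisym (⪯-left p)  (⪯-left q)  = cong left (⪯-antisym p q)
⪯-antisym (⪯-right p) (⪯-right q) = cong right (⪯-antisym p q)

lca-comm : ∀ {t} (a b : Pos t) → lca a b ≡ lca b a
lca-comm here      here      = refl
lca-comm here      (left b)  = refl
lca-comm here      (right b) = refl
lca-comm (left a)  here      = refl
lca-comm (left a)  (left b)  = cong left (lca-comm a b)
lca-comm (left a)  (right b) = refl
lca-comm (right a) here      = refl
lca-comm (right a) (left b)  = refl
lca-comm (right a) (right b) = cong right (lca-comm a b)

left-injective : ∀ {t₁ t₂} {a b : Pos t₁} → left {t₁} {t₂} a ≡ left b → a ≡ b
left-injective refl = refl

right-injective : ∀ {t₁ t₂} {a b : Pos t₂} → right {t₁} {t₂} a ≡ right b → a ≡ b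
right-injective refl = refl

-- This is where binarity is used: with a third child, c and d could lie in
-- children of lca a b different from those of a and b and from each other.
lca-cross : ∀ {t} (a b c d : LPos t) →
            lca (toPos a) (toPos b) ≡ lca (toPos a) (toPos d) →
            lca (toPos a) (toPos b) ≡ lca (toPos c) (toPos b) →
            lca (toPos c) (toPos d) ≡ lca (toPos a) (toPos b)
lca-cross here      here      here      here      _  _  = refl
lca-cross (left a)  (left b)  (left c)  (left d)  ad cb =
  cong left (lca-cross a b c d (left-injective ad) (left-injective cb))
lca-cross (left a)  (left b)  (left c)  (right d) () _
lca-cross (left a)  (left b)  (right c) d         _  ()
lca-cross (left a)  (right b) (left c)  (left d)  () _
lca-cross (left a)  (right b) (left c)  (right d) _  _  = refl
lca-cross (left a)  (right b) (right c) d         _  ()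
lca-cross (right a) (right b) (right c) (right d) ad cb =
  cong right (lca-cross a b c d (right-injective ad) (right-injective cb))
lca-cross (right a) (right b) (right c) (left d)  () _
lca-cross (right a) (right b) (left c)  d         _  ()
lca-cross (right a) (left b)  (right c) (right d) () _
lca-cross (right a) (left b)  (right c) (left d)  _  _  = refl
lca-cross (right a) (left b)  (left c)  d         _  ()

module _ {T : Tree} {S : Set} (σ : LPos T → S) where

  bestMatch-lca-unique : ∀ {x y y'} → σ y ≡ σ y' →
                         BestMatch σ x y → BestMatch σ x y' →
                         lcaL σ x y ≡ lcaL σ x y'
  bestMatch-lca-unique {y = y} {y'} σy≡σy' (_ , y-best) (_ , y'-best) =
    ⪯-antisym (y-best y' (sym σy≡σy')) (y'-best y σy≡σy')

  QBM-retarget : (u : Truncation σ) → ∀ {x y y'} → σ y ≡ σ y' →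
                 lcaL σ x y ≡ lcaL σ x y' → QBM σ u x y → QBM σ u x y'
  QBM-retarget u {x} σy≡σy' lca≡ ((σx≢σy , y-best) , truncated) =
    ( (λ σx≡σy' → σx≢σy (trans σx≡σy' (sym σy≡σy')))
    , λ z σz≡σy' → subst (_⪯ lcaL σ x z) lca≡ (y-best z (trans σz≡σy' (sym σy≡σy'))) )
    , subst₂ _⪯_ lca≡ (cong (Truncation.map u x) σy≡σy') truncated

lemma9 : (T : Tree) (S : Set) (σ : LPos T → S) (u : Truncation σ) →
    HourglassFree (QBM σ u) σ
lemma9 T S σ u x x' y y'
  (_ , _ , _ , _ , _ , _ , σx≡σx' , _ , σy≡σy' ,
   (xy , _) , (yx , _) , _ , y'x' , (xy' , _) , (yx' , _) , ¬y'x , _) =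
  ¬y'x (QBM-retarget σ u (sym σx≡σx') y'x'≡y'x y'x')
  where
  xy≡xy' : lcaL σ x y ≡ lcaL σ x y'
  xy≡xy' = bestMatch-lca-unique σ σy≡σy' xy xy'

  xy≡x'y : lcaL σ x y ≡ lcaL σ x' y
  xy≡x'y = trans (lca-comm (toPos x) (toPos y))
          (trans (bestMatch-lca-unique σ σx≡σx' yx yx')
                 (lca-comm (toPos y) (toPos x')))

  y'x'≡y'x : lcaL σ y' x' ≡ lcaL σ y' x
  y'x'≡y'x = begin
    lca (toPos y') (toPos x') ≡⟨ lca-comm (toPos y') (toPos x') ⟩
    lca (toPos x') (toPos y') ≡⟨ lca-cross x y x' y' xy≡xy' xy≡x'y ⟩
    lca (toPos x) (toPos y)   ≡⟨ xy≡xy' ⟩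
    lca (toPos x) (toPos y')  ≡⟨ lca-comm (toPos x) (toPos y') ⟩
    lca (toPos y') (toPos x)  ∎
    where open ≡-Reasoning
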